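{- Let $V$ be a finite set with $n=2m+1$ elements and let $\mu^-,\mu^+$ be Steiner quasigroups on $V$. Then $(\mu^-,\mu^+)$ is a Steiner surface on $V$ if and only if for every $x\in V$ the permutation $\sigma(\mu^-,x,\mu^+)$ has cycle structure $1^1m^2$ (i.e. exactly one fixed point and two cycles of length $m$).
   Context: A Steiner quasigroup on $V$ is a binary operation $\mu\colon V\times V\to V$ with $\mu(x,x)=x$, $\mu(x,y)=\mu(y,x)$ and $\mu(x,\mu(x,y))=y$ for all $x,y\in V$. Its Steiner triple system is $S(\mu)=\{\{x,y,\mu(x,y)\}\mid x,y\in V,\ x\neq y\}$. The transition permutation $\sigma=\sigma(\mu^-,x,\mu^+)$ of $V$ is defined by $y^{\sigma}=\mu^-(x,\mu^+(x,y))$ for $y\in V$. The pair $(\mu^-,\mu^+)$ is a Steiner surface on $V$ if $S(\mu^-)\cap S(\mu^+)=\emptyset$ and the simplicial complex generated by $S(\mu^-)\cup S(\mu^+)$ is a combinatorial surface (every vertex link is a single cycle). -}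

module Defs where

open import Data.Nat using (ℕ; zero; suc; _+_; _*_; _≤_; _<_)
open import Data.Fin using (Fin; toℕ; fromℕ<)
open import Data.Fin.Subset using (Subset; ⁅_⁆; _∪_)
open import Data.Product using (Σ; ∃; ∃-syntax; _×_; _,_)
open import Data.Sum using (_⊎_)
open import Data.Empty using (⊥)
open import Relation.Nullary using (¬_)
open import Relation.Binary.PropositionalEquality using (_≡_; _≢_)
open import Function.Bundles using (_⇔_)
open import Data.Nat.DivMod using (_%_)

Op : ℕ → Set
Op n = Fin n → Fin n → Fin n

record IsSteinerQuasigroup {n : ℕ} (μ : Op n) : Set where
  field
    idem : ∀ x → μ x x ≡ x
    comm : ∀ x y → μ x y ≡ μ y x
    cancel : ∀ x y → μ x (μ x y) ≡ y

triple : {n : ℕ} → Fin n → Fin n → Fin n → Subset n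
triple x y z = ⁅ x ⁆ ∪ ⁅ y ⁆ ∪ ⁅ z ⁆

InSTS : {n : ℕ} → Op n → Subset n → Set
InSTS μ T = ∃[ x ] ∃[ y ] (x ≢ y × T ≡ triple x y (μ x y))

-- The triangles of the simplicial complex generated by S(μ⁻) ∪ S(μ⁺).
Triangle : {n : ℕ} → Op n → Op n → Subset n → Set
Triangle μ⁻ μ⁺ T = InSTS μ⁻ T ⊎ InSTS μ⁺ T

-- Link of vertex v: edge {a,b} iff {v,a,b} is a triangle; vertex u iff
-- {v,u} is an edge of the complex (i.e. lies in some triangle).
LinkEdge : {n : ℕ} → Op n → Op n → Fin n → Fin n → Fin n → Set
LinkEdge μ⁻ μ⁺ v a b = a ≢ v × b ≢ v × a ≢ b × Triangle μ⁻ μ⁺ (triple v a b)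

LinkVertex : {n : ℕ} → Op n → Op n → Fin n → Fin n → Set
LinkVertex μ⁻ μ⁺ v u = ∃[ b ] LinkEdge μ⁻ μ⁺ v u b

nextMod : (k : ℕ) → Fin (suc k) → Fin (suc k)
nextMod k i = fromℕ< (Data.Nat.DivMod.m%n<n (suc (toℕ i)) (suc k))

IsSingleCycle : {n : ℕ} → (Fin n → Set) → (Fin n → Fin n → Set) → Set
IsSingleCycle {n} P E =
  ∃[ k ] (3 ≤ suc k × Σ (Fin (suc k) → Fin n) λ f →
      (∀ i j → f i ≡ f j → i ≡ j)
    × (∀ u → P u ⇔ (∃[ i ] f i ≡ u))
    × (∀ a b → E a b ⇔ (∃[ i ] ((a ≡ f i × b ≡ f (nextMod k i))
                              ⊎ (b ≡ f i × a ≡ f (nextMod k i))))))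

IsSteinerSurface : {n : ℕ} → Op n → Op n → Set
IsSteinerSurface μ⁻ μ⁺ =
    (∀ T → InSTS μ⁻ T → InSTS μ⁺ T → ⊥)
  × (∀ v → IsSingleCycle (LinkVertex μ⁻ μ⁺ v) (LinkEdge μ⁻ μ⁺ v))

transition : {n : ℕ} → Op n → Fin n → Op n → Fin n → Fin n
transition μ⁻ x μ⁺ y = μ⁻ x (μ⁺ x y)

iter : {A : Set} → (A → A) → ℕ → A → A
iter f zero a = a
iter f (suc k) a = f (iter f k a)

CycleLength : {n : ℕ} → (Fin n → Fin n) → Fin n → ℕ → Set
CycleLength σ y k =
  1 ≤ k × iter σ k y ≡ y × (∀ j → 1 ≤ j → j < k → iter σ j y ≢ y)

SameCycle : {n : ℕ} → (Fin n → Fin n) → Fin n → Fin n → Set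
SameCycle σ a b = ∃[ k ] iter σ k a ≡ b

HasCycleType1m2 : {n : ℕ} → (Fin n → Fin n) → ℕ → Set
HasCycleType1m2 σ m =
    (∃[ z ] (σ z ≡ z × ∀ y → σ y ≡ y → y ≡ z))
  × (∃[ a ] ∃[ b ] (CycleLength σ a m × CycleLength σ b m
       × ¬ SameCycle σ a b
       × (∀ y → σ y ≢ y → SameCycle σ a y ⊎ SameCycle σ b y)))

-- Fix x and put α = μ⁺(x, ·), β = μ⁻(x, ·): involutions of V whose only fixed point is x, with
-- σ(μ⁻, x, μ⁺) = β ∘ α.  The link of x is the graph on V ∖ {x} whose edges are the pairs {c, α c} and
-- {c, β c}, the union of two perfect matchings, and S(μ⁻) ∩ S(μ⁺) = ∅ says that the matchings share
-- no edge, i.e. that x is the only fixed point of σ.  Since α conjugates σ to σ⁻¹, the alternating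
-- walk c, α c, σ c, α σ c, … runs through the σ-cycle of c at its even steps and through the σ-cycle
-- of α c at its odd steps, and these cycles are disjoint and of equal length.  So the link is one
-- cycle (necessarily of length 2m) exactly when σ has, besides x, two cycles of length m.

module Submission where

open import Defs
open import Data.Nat using (ℕ; zero; suc; _+_; _*_; _∸_; _≤_; _<_; z≤n; s≤s; NonZero; >-nonZero; pred)
open import Data.Nat.Properties
open import Data.Nat.DivMod using (_%_; _/_; _mod_; m%n<n; m%n≤n; m≡m%n+[m/n]*n; m<n⇒m%n≡m; [m+n]%n≡m%n; %-distribˡ-+; m%n%n≡m%n; m≤n⇒[n∸m]%m≡n%m)
open import Data.Fin using (Fin; toℕ; punchIn; punchOut) renaming (zero to fzero)
open import Data.Fin.Properties using (toℕ-fromℕ<; toℕ-injective; toℕ<n; injective⇒≤; punchOut-injective; punchInᵢ≢i; punchIn-injective) renaming (_≟_ to _≟ᶠ_)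
open import Data.Fin.Subset using (⁅_⁆; _∈_)
open import Data.Fin.Subset.Properties using (x∈⁅x⁆; x∈⁅y⁆⇒x≡y; x∈p∪q⁻; x∈p∪q⁺)
open import Data.Product using (∃; ∃-syntax; _×_; _,_; proj₁; proj₂)
open import Data.Sum using (_⊎_; inj₁; inj₂)
open import Data.Empty using (⊥; ⊥-elim)
open import Function using (_∘_)
open import Function.Bundles using (_⇔_; mk⇔; Equivalence)
open import Function.Construct.Composition using (_⇔-∘_)
open import Function.Construct.Symmetry using (⇔-sym)
open import Function.Definitions using (Injective)
open import Relation.Binary.Definitions using (tri<; tri≈; tri>)
open import Relation.Nullary using (¬_; yes; no)
open import Relation.Binary.PropositionalEquality using (_≡_; _≢_; refl; sym; trans; cong; subst; subst₂; module ≡-Reasoning)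

-- Iteration and the cyclic successor

module _ {A : Set} {f : A → A} where

  iter-+ : ∀ i j a → iter f (i + j) a ≡ iter f i (iter f j a)
  iter-+ zero    j a = refl
  iter-+ (suc i) j a = cong f (iter-+ i j a)

  iter-suc : ∀ k a → iter f (suc k) a ≡ iter f k (f a)
  iter-suc zero    a = refl
  iter-suc (suc k) a = cong f (iter-suc k a)

  iter-injective : Injective _≡_ _≡_ f → ∀ k → Injective _≡_ _≡_ (iter f k)
  iter-injective f-inj zero    e = e
  iter-injective f-inj (suc k) e = iter-injective f-inj k (f-inj e)

  iter-fixedPoint : ∀ {a} → f a ≡ a → ∀ k → iter f k a ≡ a
  iter-fixedPoint e zero    = refl
  iter-fixedPoint e (suc k) = trans (cong f (iter-fixedPoint e k)) e

  iter-*-period : ∀ {a} p → iter f p a ≡ a → ∀ q → iter f (q * p) a ≡ a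
  iter-*-period p e zero    = refl
  iter-*-period {a} p e (suc q) = trans (iter-+ p (q * p) a) (trans (cong (iter f p) (iter-*-period p e q)) e)

  iter-%-period : ∀ {a} p .{{_ : NonZero p}} → iter f p a ≡ a → ∀ l → iter f l a ≡ iter f (l % p) a
  iter-%-period {a} p e l = begin
    iter f l a                                ≡⟨ cong (λ t → iter f t a) (m≡m%n+[m/n]*n l p) ⟩
    iter f (l % p + l / p * p) a              ≡⟨ iter-+ (l % p) (l / p * p) a ⟩
    iter f (l % p) (iter f (l / p * p) a)     ≡⟨ cong (iter f (l % p)) (iter-*-period p e (l / p)) ⟩
    iter f (l % p) a                          ∎
    where open ≡-Reasoning

even-or-odd : ∀ j → ∃[ i ] (j ≡ i + i ⊎ j ≡ suc (i + i))
even-or-odd zero = 0 , inj₁ refl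
even-or-odd (suc j) with even-or-odd j
... | i , inj₁ refl = i , inj₂ refl
... | i , inj₂ refl = suc i , inj₁ (cong suc (sym (+-suc i i)))

double-<-cancel : ∀ {i j} → i + i < j + j → i < j
double-<-cancel lt = ≰⇒> (λ j≤i → <⇒≱ lt (+-mono-≤ j≤i j≤i))

suc-%-% : ∀ a n .{{_ : NonZero n}} → suc (a % n) % n ≡ suc a % n
suc-%-% a n = begin
  (1 + a % n) % n          ≡⟨ %-distribˡ-+ 1 (a % n) n ⟩
  (1 % n + a % n % n) % n  ≡⟨ cong (λ t → (1 % n + t) % n) (m%n%n≡m%n a n) ⟩
  (1 % n + a % n) % n      ≡⟨ %-distribˡ-+ 1 a n ⟨
  (1 + a) % n              ∎
  where open ≡-Reasoning

CycleEdge : {A : Set} (k : ℕ) → (Fin (suc k) → A) → A → A → Set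
CycleEdge k f a b = ∃[ i ] ((a ≡ f i × b ≡ f (nextMod k i)) ⊎ (b ≡ f i × a ≡ f (nextMod k i)))

CycleEdge-sym : ∀ {A : Set} {k} {f : Fin (suc k) → A} {a b} → CycleEdge k f a b → CycleEdge k f b a
CycleEdge-sym (i , inj₁ (a≡ , b≡)) = i , inj₂ (a≡ , b≡)
CycleEdge-sym (i , inj₂ (b≡ , a≡)) = i , inj₁ (b≡ , a≡)

module _ (k : ℕ) where

  toℕ-nextMod : ∀ i → toℕ (nextMod k i) ≡ suc (toℕ i) % suc k
  toℕ-nextMod i = toℕ-fromℕ< (m%n<n (suc (toℕ i)) (suc k))

  toℕ-iter-nextMod : ∀ d i → toℕ (iter (nextMod k) d i) ≡ (toℕ i + d) % suc k
  toℕ-iter-nextMod zero i = begin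
    toℕ i                ≡⟨ m<n⇒m%n≡m (toℕ<n i) ⟨
    toℕ i % suc k        ≡⟨ cong (_% suc k) (+-identityʳ (toℕ i)) ⟨
    (toℕ i + 0) % suc k  ∎
    where open ≡-Reasoning
  toℕ-iter-nextMod (suc d) i = begin
    toℕ (nextMod k (iter (nextMod k) d i))  ≡⟨ toℕ-nextMod (iter (nextMod k) d i) ⟩
    suc (toℕ (iter (nextMod k) d i)) % suc k ≡⟨ cong (λ t → suc t % suc k) (toℕ-iter-nextMod d i) ⟩
    suc ((toℕ i + d) % suc k) % suc k        ≡⟨ suc-%-% (toℕ i + d) (suc k) ⟩
    suc (toℕ i + d) % suc k                  ≡⟨ cong (_% suc k) (+-suc (toℕ i) d) ⟨
    (toℕ i + suc d) % suc k                  ∎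
    where open ≡-Reasoning

  iter-nextMod-period : ∀ i → iter (nextMod k) (suc k) i ≡ i
  iter-nextMod-period i = toℕ-injective (begin
    toℕ (iter (nextMod k) (suc k) i) ≡⟨ toℕ-iter-nextMod (suc k) i ⟩
    (toℕ i + suc k) % suc k          ≡⟨ [m+n]%n≡m%n (toℕ i) (suc k) ⟩
    toℕ i % suc k                    ≡⟨ m<n⇒m%n≡m (toℕ<n i) ⟩
    toℕ i                            ∎)
    where open ≡-Reasoning

  iter-nextMod-aperiodic : ∀ {d} i → 0 < d → d < suc k → iter (nextMod k) d i ≢ i
  iter-nextMod-aperiodic {d} i 0<d d<K e with toℕ i + d <? suc k
  ... | yes t+d<K = <-irrefl (sym (trans (sym (m<n⇒m%n≡m t+d<K)) returns)) (m<m+n (toℕ i) 0<d)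
    where
      returns : (toℕ i + d) % suc k ≡ toℕ i
      returns = trans (sym (toℕ-iter-nextMod d i)) (cong toℕ e)
  ... | no t+d≮K = <-irrefl wrapped r<t
    where
      K≤t+d : suc k ≤ toℕ i + d
      K≤t+d = ≮⇒≥ t+d≮K
      r<t : toℕ i + d ∸ suc k < toℕ i
      r<t = +-cancelʳ-< (suc k) _ _
              (subst (_< toℕ i + suc k) (sym (m∸n+n≡m K≤t+d)) (+-monoʳ-< (toℕ i) d<K))
      wrapped : toℕ i + d ∸ suc k ≡ toℕ i
      wrapped = begin
        toℕ i + d ∸ suc k             ≡⟨ m<n⇒m%n≡m (<-trans r<t (toℕ<n i)) ⟨
        (toℕ i + d ∸ suc k) % suc k    ≡⟨ m≤n⇒[n∸m]%m≡n%m K≤t+d ⟩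
        (toℕ i + d) % suc k            ≡⟨ toℕ-iter-nextMod d i ⟨
        toℕ (iter (nextMod k) d i)     ≡⟨ cong toℕ e ⟩
        toℕ i                          ∎
        where open ≡-Reasoning

  iter-nextMod-reaches : ∀ i j → ∃[ d ] iter (nextMod k) d i ≡ j
  iter-nextMod-reaches i j = toℕ j + (suc k ∸ toℕ i) , toℕ-injective (begin
    toℕ (iter (nextMod k) (toℕ j + (suc k ∸ toℕ i)) i) ≡⟨ toℕ-iter-nextMod _ i ⟩
    (toℕ i + (toℕ j + (suc k ∸ toℕ i))) % suc k        ≡⟨ cong (_% suc k) (+-comm (toℕ i) _) ⟩
    (toℕ j + (suc k ∸ toℕ i) + toℕ i) % suc k          ≡⟨ cong (_% suc k) (+-assoc (toℕ j) _ (toℕ i)) ⟩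
    (toℕ j + (suc k ∸ toℕ i + toℕ i)) % suc k          ≡⟨ cong (λ t → (toℕ j + t) % suc k) (m∸n+n≡m (<⇒≤ (toℕ<n i))) ⟩
    (toℕ j + suc k) % suc k                            ≡⟨ [m+n]%n≡m%n (toℕ j) (suc k) ⟩
    toℕ j % suc k                                      ≡⟨ m<n⇒m%n≡m (toℕ<n j) ⟩
    toℕ j                                              ∎)
    where open ≡-Reasoning

  nextMod-injective : Injective _≡_ _≡_ (nextMod k)
  nextMod-injective {i} {j} e = begin
    i                                  ≡⟨ iter-nextMod-period i ⟨
    iter (nextMod k) (suc k) i         ≡⟨ iter-suc k i ⟩
    iter (nextMod k) k (nextMod k i)   ≡⟨ cong (iter (nextMod k) k) e ⟩
    iter (nextMod k) k (nextMod k j)   ≡⟨ iter-suc k j ⟨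
    iter (nextMod k) (suc k) j         ≡⟨ iter-nextMod-period j ⟩
    j                                  ∎
    where open ≡-Reasoning

module _ {A : Set} (k : ℕ) {F : ℕ → A} (periodic : ∀ j → F (suc k + j) ≡ F j) where

  periodic-* : ∀ q r → F (q * suc k + r) ≡ F r
  periodic-* zero    r = refl
  periodic-* (suc q) r = trans (cong F (+-assoc (suc k) (q * suc k) r)) (trans (periodic _) (periodic-* q r))

  periodic-% : ∀ j → F j ≡ F (j % suc k)
  periodic-% j = begin
    F j                                ≡⟨ cong F (trans (m≡m%n+[m/n]*n j (suc k)) (+-comm (j % suc k) _)) ⟩
    F (j / suc k * suc k + j % suc k)  ≡⟨ periodic-* (j / suc k) (j % suc k) ⟩
    F (j % suc k)                      ∎
    where open ≡-Reasoning

  periodic-mod : ∀ j → F (toℕ (j mod suc k)) ≡ F j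
  periodic-mod j = trans (cong F (toℕ-fromℕ< (m%n<n j (suc k)))) (sym (periodic-% j))

  periodic-nextMod : ∀ i → F (toℕ (nextMod k i)) ≡ F (suc (toℕ i))
  periodic-nextMod i = trans (cong F (toℕ-nextMod k i)) (sym (periodic-% (suc (toℕ i))))

  periodic-cycleEdge : ∀ j → CycleEdge k (F ∘ toℕ) (F j) (F (suc j))
  periodic-cycleEdge j = j mod suc k , inj₁ (sym (periodic-mod j) , sym next-mod)
    where
      next-mod : F (toℕ (nextMod k (j mod suc k))) ≡ F (suc j)
      next-mod = begin
        F (toℕ (nextMod k (j mod suc k)))   ≡⟨ cong F (toℕ-nextMod k (j mod suc k)) ⟩
        F (suc (toℕ (j mod suc k)) % suc k) ≡⟨ cong (λ t → F (suc t % suc k)) (toℕ-fromℕ< (m%n<n j (suc k))) ⟩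
        F (suc (j % suc k) % suc k)         ≡⟨ cong F (suc-%-% j (suc k)) ⟩
        F (suc j % suc k)                   ≡⟨ periodic-% (suc j) ⟨
        F (suc j)                           ∎
        where open ≡-Reasoning

complement-enumeration-size : ∀ {K N} {f : Fin K → Fin (suc N)} {x} → Injective _≡_ _≡_ f →
                            (∀ u → u ≢ x ⇔ (∃[ i ] f i ≡ u)) → K ≡ N
complement-enumeration-size {K} {N} {f} {x} f-inj enumerates = ≤-antisym (injective⇒≤ out-inj) (injective⇒≤ in-inj)
  where
    x≢f : ∀ i → x ≢ f i
    x≢f i e = Equivalence.from (enumerates (f i)) (i , refl) (sym e)
    out : Fin K → Fin N
    out i = punchOut (x≢f i)
    out-inj : Injective _≡_ _≡_ out
    out-inj {i} {j} e = f-inj (punchOut-injective (x≢f i) (x≢f j) e)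
    preimage : ∀ j → ∃[ i ] f i ≡ punchIn x j
    preimage j = Equivalence.to (enumerates (punchIn x j)) (punchInᵢ≢i x j)
    in-inj : Injective _≡_ _≡_ (proj₁ ∘ preimage)
    in-inj {j} {j′} e = punchIn-injective x j j′
      (trans (sym (proj₂ (preimage j))) (trans (cong f e) (proj₂ (preimage j′))))

CycleLength-iter-distinct : ∀ {n} {f : Fin n → Fin n} {a m} → Injective _≡_ _≡_ f → CycleLength f a m →
                            ∀ {i j} → i < j → j < m → iter f i a ≢ iter f j a
CycleLength-iter-distinct {f = f} {a} f-inj (_ , _ , minimal) {i} {j} i<j j<m e =
  minimal (j ∸ i) (m<n⇒0<n∸m i<j) (≤-<-trans (m∸n≤m j i) j<m) (iter-injective f-inj i (begin
    iter f i (iter f (j ∸ i) a) ≡⟨ iter-+ i (j ∸ i) a ⟨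
    iter f (i + (j ∸ i)) a      ≡⟨ cong (λ t → iter f t a) (m+[n∸m]≡n (<⇒≤ i<j)) ⟩
    iter f j a                  ≡⟨ e ⟨
    iter f i a                  ∎))
  where open ≡-Reasoning

CycleLength-orbit-injective : ∀ {n} {f : Fin n → Fin n} {a m} → Injective _≡_ _≡_ f → CycleLength f a m →
                              ∀ {i j} → i < m → j < m → iter f i a ≡ iter f j a → i ≡ j
CycleLength-orbit-injective f-inj cycle {i} {j} i<m j<m e with <-cmp i j
... | tri< i<j _ _ = ⊥-elim (CycleLength-iter-distinct f-inj cycle i<j j<m e)
... | tri≈ _ i≡j _ = i≡j
... | tri> _ _ j<i = ⊥-elim (CycleLength-iter-distinct f-inj cycle j<i i<m (sym e))

IsSingleCycle-resp : ∀ {n} {P P′ : Fin n → Set} {E E′ : Fin n → Fin n → Set} →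
                     (∀ u → P u ⇔ P′ u) → (∀ a b → E a b ⇔ E′ a b) → IsSingleCycle P E → IsSingleCycle P′ E′
IsSingleCycle-resp P⇔P′ E⇔E′ (k , 3≤k , f , f-inj , vertices , edges) =
  k , 3≤k , f , f-inj , (λ u → vertices u ⇔-∘ ⇔-sym (P⇔P′ u)) , (λ a b → edges a b ⇔-∘ ⇔-sym (E⇔E′ a b))

-- Two involutions with a common unique fixed point

record IsInvolutionFixingOnly {A : Set} (f : A → A) (x : A) : Set where
  field
    involutive : ∀ y → f (f y) ≡ y
    fixes      : f x ≡ x
    fixed⇒≡    : ∀ {y} → f y ≡ y → y ≡ x

  injective : Injective _≡_ _≡_ f
  injective {u} {v} e = trans (sym (involutive u)) (trans (cong f e) (involutive v))

  preimage-fixed : ∀ {y} → f y ≡ x → y ≡ x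
  preimage-fixed e = injective (trans e (sym fixes))

MatchingEdge : {A : Set} → (A → A) → (A → A) → A → A → A → Set
MatchingEdge α β x a b = a ≢ x × (b ≡ β a ⊎ b ≡ α a)

module InvolutionPair {n : ℕ} {α β : Fin n → Fin n} {x : Fin n}
                      (α-inv : IsInvolutionFixingOnly α x) (β-inv : IsInvolutionFixingOnly β x) where

  private
    module α = IsInvolutionFixingOnly α-inv
    module β = IsInvolutionFixingOnly β-inv

  σ : Fin n → Fin n
  σ = β ∘ α

  σ-injective : Injective _≡_ _≡_ σ
  σ-injective e = α.injective (β.injective e)

  σ-fixes : σ x ≡ x
  σ-fixes = trans (cong β α.fixes) β.fixes

  σ-moves⇒≢x : ∀ {y} → σ y ≢ y → y ≢ x
  σ-moves⇒≢x σy≢y y≡x = σy≢y (trans (cong σ y≡x) (trans σ-fixes (sym y≡x)))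

  iter-σ-preimage-fixed : ∀ i {c} → iter σ i c ≡ x → c ≡ x
  iter-σ-preimage-fixed i e = iter-injective σ-injective i (trans e (sym (iter-fixedPoint σ-fixes i)))

  σ-fixed⇒≡⇔α≢β : (∀ y → σ y ≡ y → y ≡ x) ⇔ (∀ y → y ≢ x → α y ≢ β y)
  σ-fixed⇒≡⇔α≢β = mk⇔ to from
    where
      to : (∀ y → σ y ≡ y → y ≡ x) → ∀ y → y ≢ x → α y ≢ β y
      to fixed y y≢x e = y≢x (fixed y (trans (cong β e) (β.involutive y)))
      from : (∀ y → y ≢ x → α y ≢ β y) → ∀ y → σ y ≡ y → y ≡ x
      from differ y e with y ≟ᶠ x
      ... | yes y≡x = y≡x
      ... | no  y≢x = ⊥-elim (differ y y≢x (trans (sym (β.involutive (α y))) (cong β e)))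

  σ∘α∘σ≡α : ∀ y → σ (α (σ y)) ≡ α y
  σ∘α∘σ≡α y = trans (cong β (α.involutive (β (α y)))) (β.involutive (α y))

  σ^p∘α∘σ^p≡α : ∀ p c → iter σ p (α (iter σ p c)) ≡ α c
  σ^p∘α∘σ^p≡α zero    c = refl
  σ^p∘α∘σ^p≡α (suc p) c = begin
    iter σ (suc p) (α (σ (iter σ p c)))  ≡⟨ iter-suc p _ ⟩
    iter σ p (σ (α (σ (iter σ p c))))    ≡⟨ cong (iter σ p) (σ∘α∘σ≡α (iter σ p c)) ⟩
    iter σ p (α (iter σ p c))            ≡⟨ σ^p∘α∘σ^p≡α p c ⟩
    α c                                  ∎
    where open ≡-Reasoning

  α∘σ^p≢σ^q : ∀ {c} → c ≢ x → ∀ p q → α (iter σ p c) ≢ iter σ q c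
  α∘σ^p≢σ^q {c} c≢x p q e = α-off-orbit (p + q) (begin
    α c                        ≡⟨ σ^p∘α∘σ^p≡α p c ⟨
    iter σ p (α (iter σ p c))  ≡⟨ cong (iter σ p) e ⟩
    iter σ p (iter σ q c)      ≡⟨ iter-+ p q c ⟨
    iter σ (p + q) c           ∎)
    where
      open ≡-Reasoning
      -- α c = σ^(2i) c makes σ^i c a fixed point of α, and α c = σ^(2i+1) c one of β.
      α-off-orbit : ∀ k → α c ≢ iter σ k c
      α-off-orbit k e with even-or-odd k
      ... | i , inj₁ refl = c≢x (iter-σ-preimage-fixed i (α.fixed⇒≡ (iter-injective σ-injective i (begin
        iter σ i (α (iter σ i c))  ≡⟨ σ^p∘α∘σ^p≡α i c ⟩
        α c                        ≡⟨ e ⟩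
        iter σ (i + i) c           ≡⟨ iter-+ i i c ⟩
        iter σ i (iter σ i c)      ∎))))
      ... | i , inj₂ refl = c≢x (iter-σ-preimage-fixed i (α.preimage-fixed (β.fixed⇒≡ (sym
        (iter-injective σ-injective i (begin
        iter σ i (α (iter σ i c))      ≡⟨ σ^p∘α∘σ^p≡α i c ⟩
        α c                            ≡⟨ e ⟩
        iter σ (suc (i + i)) c         ≡⟨ cong (λ t → iter σ t c) (+-suc i i) ⟨
        iter σ (i + suc i) c           ≡⟨ iter-+ i (suc i) c ⟩
        iter σ i (σ (iter σ i c))      ∎))))))

  σ^j∘α≡α∘σ^[m∸j] : ∀ {a m j} → iter σ m a ≡ a → j ≤ m → iter σ j (α a) ≡ α (iter σ (m ∸ j) a)
  σ^j∘α≡α∘σ^[m∸j] {a} {m} {j} period j≤m = begin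
    iter σ j (α a)                               ≡⟨ cong (iter σ j ∘ α) returns ⟨
    iter σ j (α (iter σ j (iter σ (m ∸ j) a)))   ≡⟨ σ^p∘α∘σ^p≡α j _ ⟩
    α (iter σ (m ∸ j) a)                         ∎
    where
      open ≡-Reasoning
      returns : iter σ j (iter σ (m ∸ j) a) ≡ a
      returns = trans (sym (iter-+ j (m ∸ j) a)) (trans (cong (λ t → iter σ t a) (m+[n∸m]≡n j≤m)) period)

  α-CycleLength : ∀ {a m} → CycleLength σ a m → CycleLength σ (α a) m
  α-CycleLength {a} {m} (1≤m , period , minimal) = 1≤m , period′ , minimal′
    where
      period′ : iter σ m (α a) ≡ α a
      period′ = trans (σ^j∘α≡α∘σ^[m∸j] {m = m} period ≤-refl) (cong (λ t → α (iter σ t a)) (n∸n≡0 m))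
      minimal′ : ∀ j → 1 ≤ j → j < m → iter σ j (α a) ≢ α a
      minimal′ j 1≤j j<m e = minimal (m ∸ j) (m<n⇒0<n∸m j<m) (∸-monoʳ-< 1≤j (<⇒≤ j<m))
        (α.injective (trans (sym (σ^j∘α≡α∘σ^[m∸j] period (<⇒≤ j<m))) e))

  α-SameCycle : ∀ {a m} .{{_ : NonZero m}} → iter σ m a ≡ a → ∀ l → SameCycle σ (α a) (α (iter σ l a))
  α-SameCycle {a} {m} period l = m ∸ l % m , (begin
    iter σ (m ∸ l % m) (α a)          ≡⟨ σ^j∘α≡α∘σ^[m∸j] period (m∸n≤m m (l % m)) ⟩
    α (iter σ (m ∸ (m ∸ l % m)) a)    ≡⟨ cong (λ t → α (iter σ t a)) (m∸[m∸n]≡n (m%n≤n l m)) ⟩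
    α (iter σ (l % m) a)              ≡⟨ cong α (iter-%-period m period l) ⟨
    α (iter σ l a)                    ∎)
    where open ≡-Reasoning

  α-edge : ∀ {c} → c ≢ x → MatchingEdge α β x c (α c)
  α-edge c≢x = c≢x , inj₂ refl

  β-edge : ∀ {c} → c ≢ x → MatchingEdge α β x c (β c)
  β-edge c≢x = c≢x , inj₁ refl

  walk : ℕ → Fin n → Fin n
  walk zero          c = c
  walk (suc zero)    c = α c
  walk (suc (suc j)) c = walk j (σ c)

  walk-+ : ∀ i j c → walk (i + i + j) c ≡ walk j (iter σ i c)
  walk-+ zero    j c = refl
  walk-+ (suc i) j c = begin
    walk (suc (i + suc i + j)) c      ≡⟨ cong (λ t → walk (suc (t + j)) c) (+-suc i i) ⟩
    walk (i + i + j) (σ c)            ≡⟨ walk-+ i j (σ c) ⟩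
    walk j (iter σ i (σ c))           ≡⟨ cong (walk j) (iter-suc i c) ⟨
    walk j (iter σ (suc i) c)         ∎
    where open ≡-Reasoning

  walk-even : ∀ i c → walk (i + i) c ≡ iter σ i c
  walk-even i c = trans (cong (λ t → walk t c) (sym (+-identityʳ (i + i)))) (walk-+ i 0 c)

  walk-odd : ∀ i c → walk (suc (i + i)) c ≡ α (iter σ i c)
  walk-odd i c = trans (cong (λ t → walk t c) (+-comm 1 (i + i))) (walk-+ i 1 c)

  walk-≢ : ∀ {c} → c ≢ x → ∀ j → walk j c ≢ x
  walk-≢ c≢x zero          = c≢x
  walk-≢ c≢x (suc zero)    = c≢x ∘ α.preimage-fixed
  walk-≢ c≢x (suc (suc j)) = walk-≢ (c≢x ∘ iter-σ-preimage-fixed 1) j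

  walk-neighbours : ∀ j c →
    (α (walk (suc j) c) ≡ walk j c × β (walk (suc j) c) ≡ walk (suc (suc j)) c) ⊎
    (α (walk (suc j) c) ≡ walk (suc (suc j)) c × β (walk (suc j) c) ≡ walk j c)
  walk-neighbours zero          c = inj₁ (α.involutive c , refl)
  walk-neighbours (suc zero)    c = inj₂ (refl , β.involutive (α c))
  walk-neighbours (suc (suc j)) c = walk-neighbours j (σ c)

  walk-neighbour : ∀ j c {q} → q ≡ β (walk (suc j) c) ⊎ q ≡ α (walk (suc j) c) →
                   q ≡ walk j c ⊎ q ≡ walk (suc (suc j)) c
  walk-neighbour j c q≡ with walk-neighbours j c | q≡
  ... | inj₁ (_ , β≡) | inj₁ q≡β = inj₂ (trans q≡β β≡)
  ... | inj₁ (α≡ , _) | inj₂ q≡α = inj₁ (trans q≡α α≡)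
  ... | inj₂ (_ , β≡) | inj₁ q≡β = inj₁ (trans q≡β β≡)
  ... | inj₂ (α≡ , _) | inj₂ q≡α = inj₂ (trans q≡α α≡)

  walk-edge : ∀ {c} → c ≢ x → ∀ j → MatchingEdge α β x (walk j c) (walk (suc j) c)
  walk-edge c≢x zero = α-edge c≢x
  walk-edge {c} c≢x (suc j) with walk-neighbours j c
  ... | inj₁ (_ , β≡) = walk-≢ c≢x (suc j) , inj₁ (sym β≡)
  ... | inj₂ (α≡ , _) = walk-≢ c≢x (suc j) , inj₂ (sym α≡)

  walk-edge-back : ∀ {c} → c ≢ x → ∀ j → MatchingEdge α β x (walk (suc j) c) (walk j c)
  walk-edge-back {c} c≢x j with walk-neighbours j c
  ... | inj₁ (α≡ , _) = walk-≢ c≢x (suc j) , inj₂ (sym α≡)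
  ... | inj₂ (_ , β≡) = walk-≢ c≢x (suc j) , inj₁ (sym β≡)

module CycleType⇒SingleCycle {m : ℕ} {α β : Fin (suc (m + m)) → Fin (suc (m + m))} {x : Fin (suc (m + m))}
    (α-inv : IsInvolutionFixingOnly α x) (β-inv : IsInvolutionFixingOnly β x)
    (fixed⇒x : ∀ y → (β ∘ α) y ≡ y → y ≡ x)
    {a b : Fin (suc (m + m))}
    (a-cycle : CycleLength (β ∘ α) a m) (b-cycle : CycleLength (β ∘ α) b m)
    (a≁b : ¬ SameCycle (β ∘ α) a b)
    (covered : ∀ y → (β ∘ α) y ≢ y → SameCycle (β ∘ α) a y ⊎ SameCycle (β ∘ α) b y) where

  open InvolutionPair α-inv β-inv
  private module α = IsInvolutionFixingOnly α-inv

  -- for m = 1 both a and b would be fixed by σ, hence equal to x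
  2≤m : 2 ≤ m
  2≤m = ≰⇒> λ m≤1 →
    let fixed : ∀ {c} → CycleLength σ c m → c ≡ x
        fixed {c} (_ , period , _) =
          fixed⇒x c (subst (λ t → iter σ t c ≡ c) (≤-antisym m≤1 (proj₁ a-cycle)) period)
    in a≁b (0 , trans (fixed a-cycle) (sym (fixed b-cycle)))

  cycle-≢x : ∀ {c} → CycleLength σ c m → c ≢ x
  cycle-≢x (_ , _ , minimal) = σ-moves⇒≢x (minimal 1 (s≤s z≤n) 2≤m)

  a≢x : a ≢ x
  a≢x = cycle-≢x a-cycle

  instance
    m-nonZero : NonZero m
    m-nonZero = >-nonZero (proj₁ a-cycle)

  a-period : iter σ m a ≡ a
  a-period = proj₁ (proj₂ a-cycle)

  F : ℕ → Fin (suc (m + m))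
  F j = walk j a

  k : ℕ
  k = pred m + m

  K≡ : suc k ≡ m + m
  K≡ = cong (_+ m) (suc-pred m)

  F-periodic : ∀ j → F (suc k + j) ≡ F j
  F-periodic j = begin
    F (suc k + j)       ≡⟨ cong (λ t → F (t + j)) K≡ ⟩
    walk (m + m + j) a  ≡⟨ walk-+ m j a ⟩
    walk j (iter σ m a) ≡⟨ cong (walk j) a-period ⟩
    F j                 ∎
    where open ≡-Reasoning

  F-covers : ∀ {y} → y ≢ x → ∃[ j ] F j ≡ y
  F-covers {y} y≢x with covered y (y≢x ∘ fixed⇒x y)
  ... | inj₁ (l , e) = l + l , trans (walk-even l a) e
  ... | inj₂ (l , e) with covered (α y) (y≢x ∘ α.preimage-fixed ∘ fixed⇒x (α y))
  ...   | inj₁ (l′ , e′) = suc (l′ + l′) , trans (walk-odd l′ a) (trans (cong α e′) (α.involutive y))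
  ...   | inj₂ (l′ , e′) = ⊥-elim (α∘σ^p≢σ^q (cycle-≢x b-cycle) l l′ (trans (cong α e) (sym e′)))

  a-orbit-injective : ∀ {i i′} → i < m → i′ < m → iter σ i a ≡ iter σ i′ a → i ≡ i′
  a-orbit-injective = CycleLength-orbit-injective σ-injective a-cycle

  F-injective : ∀ {j j′} → j < m + m → j′ < m + m → F j ≡ F j′ → j ≡ j′
  F-injective {j} {j′} j< j′< e with even-or-odd j | even-or-odd j′
  ... | i , inj₁ refl | i′ , inj₁ refl = cong (λ t → t + t)
    (a-orbit-injective (double-<-cancel {i} j<) (double-<-cancel {i′} j′<)
      (trans (sym (walk-even i a)) (trans e (walk-even i′ a))))
  ... | i , inj₂ refl | i′ , inj₂ refl = cong (λ t → suc (t + t))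
    (a-orbit-injective (double-<-cancel {i} (<⇒≤ j<)) (double-<-cancel {i′} (<⇒≤ j′<))
      (α.injective (trans (sym (walk-odd i a)) (trans e (walk-odd i′ a)))))
  ... | i , inj₁ refl | i′ , inj₂ refl =
    ⊥-elim (α∘σ^p≢σ^q a≢x i′ i (sym (trans (sym (walk-even i a)) (trans e (walk-odd i′ a)))))
  ... | i , inj₂ refl | i′ , inj₁ refl =
    ⊥-elim (α∘σ^p≢σ^q a≢x i i′ (trans (sym (walk-odd i a)) (trans e (walk-even i′ a))))

  f : Fin (suc k) → Fin (suc (m + m))
  f = F ∘ toℕ

  f-injective : ∀ i i′ → f i ≡ f i′ → i ≡ i′
  f-injective i i′ e = toℕ-injective (F-injective (bound i) (bound i′) e)
    where
      bound : ∀ (i : Fin (suc k)) → toℕ i < m + m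
      bound i = subst (toℕ i <_) K≡ (toℕ<n i)

  f-enumerates : ∀ u → u ≢ x ⇔ (∃[ i ] f i ≡ u)
  f-enumerates u = mk⇔ to from
    where
      to : u ≢ x → ∃[ i ] f i ≡ u
      to u≢x with F-covers u≢x
      ... | j , e = j mod suc k , trans (periodic-mod k F-periodic j) e
      from : ∃[ i ] f i ≡ u → u ≢ x
      from (i , e) u≡x = walk-≢ a≢x (toℕ i) (trans e u≡x)

  matching⇒cycleEdge : ∀ {p q} → MatchingEdge α β x p q → CycleEdge k f p q
  matching⇒cycleEdge (p≢x , q-adj) with F-covers p≢x
  ... | j , Fj≡p with trans (F-periodic j) Fj≡p
  ...   | refl with walk-neighbour (k + j) a q-adj
  ...     | inj₁ refl = CycleEdge-sym (periodic-cycleEdge k F-periodic (k + j))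
  ...     | inj₂ refl = periodic-cycleEdge k F-periodic (suc (k + j))

  cycleEdge⇒matching : ∀ {p q} → CycleEdge k f p q → MatchingEdge α β x p q
  cycleEdge⇒matching (i , inj₁ (refl , refl)) =
    subst (MatchingEdge α β x (f i)) (sym (periodic-nextMod k F-periodic i)) (walk-edge a≢x (toℕ i))
  cycleEdge⇒matching (i , inj₂ (refl , refl)) =
    subst (λ p → MatchingEdge α β x p (f i)) (sym (periodic-nextMod k F-periodic i)) (walk-edge-back a≢x (toℕ i))

  3≤K : 3 ≤ suc k
  3≤K = subst (3 ≤_) (sym K≡) (≤-trans (n≤1+n 3) (+-mono-≤ 2≤m 2≤m))

  singleCycle : IsSingleCycle (_≢ x) (MatchingEdge α β x)
  singleCycle = k , 3≤K , f , f-injective , f-enumerates , λ p q → mk⇔ matching⇒cycleEdge cycleEdge⇒matching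

module SingleCycle⇒CycleType {m : ℕ} {α β : Fin (suc (m + m)) → Fin (suc (m + m))} {x : Fin (suc (m + m))}
    (α-inv : IsInvolutionFixingOnly α x) (β-inv : IsInvolutionFixingOnly β x)
    (α≢β : ∀ y → y ≢ x → α y ≢ β y)
    {k : ℕ} (3≤K : 3 ≤ suc k) {f : Fin (suc k) → Fin (suc (m + m))}
    (f-injective : ∀ i j → f i ≡ f j → i ≡ j)
    (f-enumerates : ∀ u → u ≢ x ⇔ (∃[ i ] f i ≡ u))
    (f-edges : ∀ p q → MatchingEdge α β x p q ⇔ CycleEdge k f p q) where

  open InvolutionPair α-inv β-inv
  private
    module α = IsInvolutionFixingOnly α-inv
    module β = IsInvolutionFixingOnly β-inv
    next = nextMod k

  K≡ : suc k ≡ m + m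
  K≡ = complement-enumeration-size (f-injective _ _) f-enumerates

  f-≢x : ∀ i → f i ≢ x
  f-≢x i = Equivalence.from (f-enumerates (f i)) (i , refl)

  neighbour : ∀ i {q} → MatchingEdge α β x (f i) q → q ≡ f (next i) ⊎ ∃[ i′ ] (q ≡ f i′ × next i′ ≡ i)
  neighbour i e with Equivalence.to (f-edges (f i) _) e
  ... | i′ , inj₁ (fi≡ , q≡) = inj₁ (trans q≡ (cong (f ∘ next) (sym (f-injective _ _ fi≡))))
  ... | i′ , inj₂ (q≡ , fi≡) = inj₂ (i′ , q≡ , sym (f-injective _ _ fi≡))

  -- the other matching cannot lead back, since it differs from the one just used
  alternates : (γ δ : Fin (suc (m + m)) → Fin (suc (m + m))) → (∀ c → γ (γ c) ≡ c) →
               (∀ {c} → c ≢ x → MatchingEdge α β x c (δ c)) → (∀ {c} → c ≢ x → γ c ≢ δ c) →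
               ∀ i → γ (f i) ≡ f (next i) → δ (f (next i)) ≡ f (next (next i))
  alternates γ δ γ-involutive δ-edge γ≢δ i γ-step with neighbour (next i) (δ-edge (f-≢x (next i)))
  ... | inj₁ δ-step = δ-step
  ... | inj₂ (i′ , δ-back , next-i′≡) = ⊥-elim (γ≢δ (f-≢x (next i)) (trans γ-back (sym δ-back′)))
    where
      δ-back′ : δ (f (next i)) ≡ f i
      δ-back′ = trans δ-back (cong f (nextMod-injective k next-i′≡))
      γ-back : γ (f (next i)) ≡ f i
      γ-back = trans (cong γ (sym γ-step)) (γ-involutive (f i))

  orientation : ∃[ s ] α (f s) ≡ f (next s)
  orientation with neighbour fzero (α-edge (f-≢x fzero))
  ... | inj₁ α-step = fzero , α-step
  ... | inj₂ (i′ , α-back , next-i′≡) =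
    i′ , trans (cong α (sym α-back)) (trans (α.involutive _) (cong f (sym next-i′≡)))

  s : Fin (suc k)
  s = proj₁ orientation

  Φ : ℕ → Fin (suc (m + m))
  Φ d = f (iter next d s)

  a : Fin (suc (m + m))
  a = Φ 0

  α-step β-step : ℕ → Set
  α-step d = α (Φ d) ≡ Φ (suc d)
  β-step d = β (Φ d) ≡ Φ (suc d)

  α-step-even : ∀ l → α-step (l + l)
  β-step-odd  : ∀ l → β-step (suc (l + l))
  α-step-even zero    = proj₂ orientation
  α-step-even (suc l) = subst α-step (cong suc (sym (+-suc l l)))
    (alternates β α β.involutive α-edge (λ c≢x → α≢β _ c≢x ∘ sym) (iter next (suc (l + l)) s) (β-step-odd l))
  β-step-odd l = alternates α β α.involutive β-edge (α≢β _) (iter next (l + l) s) (α-step-even l)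

  Φ-even : ∀ l → Φ (l + l) ≡ iter σ l a
  Φ-even zero    = refl
  Φ-even (suc l) = begin
    Φ (suc l + suc l)       ≡⟨ cong (Φ ∘ suc) (+-suc l l) ⟩
    Φ (suc (suc (l + l)))   ≡⟨ β-step-odd l ⟨
    β (Φ (suc (l + l)))     ≡⟨ cong β (α-step-even l) ⟨
    σ (Φ (l + l))           ≡⟨ cong σ (Φ-even l) ⟩
    σ (iter σ l a)          ∎
    where open ≡-Reasoning

  Φ-odd : ∀ l → Φ (suc (l + l)) ≡ α (iter σ l a)
  Φ-odd l = trans (sym (α-step-even l)) (cong α (Φ-even l))

  1≤m : 1 ≤ m
  1≤m = double-<-cancel (≤-trans (s≤s z≤n) (subst (3 ≤_) K≡ 3≤K))

  instance
    m-nonZero : NonZero m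
    m-nonZero = >-nonZero 1≤m

  a≢x : a ≢ x
  a≢x = f-≢x s

  a-period : iter σ m a ≡ a
  a-period = begin
    iter σ m a               ≡⟨ Φ-even m ⟨
    f (iter next (m + m) s)  ≡⟨ cong (λ t → f (iter next t s)) K≡ ⟨
    f (iter next (suc k) s)  ≡⟨ cong f (iter-nextMod-period k s) ⟩
    a                        ∎
    where open ≡-Reasoning

  a-cycle : CycleLength σ a m
  a-cycle = 1≤m , a-period , λ j 1≤j j<m e → iter-nextMod-aperiodic k s (≤-trans 1≤j (m≤m+n j j))
    (subst (j + j <_) (sym K≡) (+-mono-< j<m j<m)) (f-injective _ _ (trans (Φ-even j) e))

  Φ-covers : ∀ {y} → y ≢ x → ∃[ d ] Φ d ≡ y
  Φ-covers {y} y≢x with Equivalence.to (f-enumerates y) y≢x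
  ... | i , fi≡y with iter-nextMod-reaches k s i
  ...   | d , reaches = d , trans (cong f reaches) fi≡y

  covered : ∀ y → σ y ≢ y → SameCycle σ a y ⊎ SameCycle σ (α a) y
  covered y σy≢y with Φ-covers (σ-moves⇒≢x σy≢y)
  ... | d , Φd≡y with even-or-odd d
  ...   | l , inj₁ refl = inj₁ (l , trans (sym (Φ-even l)) Φd≡y)
  ...   | l , inj₂ refl with α-SameCycle a-period l
  ...     | q , e = inj₂ (q , trans e (trans (sym (Φ-odd l)) Φd≡y))

  cycleType : HasCycleType1m2 σ m
  cycleType = (x , σ-fixes , Equivalence.from σ-fixed⇒≡⇔α≢β α≢β)
            , (a , α a , a-cycle , α-CycleLength a-cycle , (λ (q , e) → α∘σ^p≢σ^q a≢x 0 q (sym e)) , covered)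

matchingUnion⇔cycleType : ∀ {m} {α β : Fin (suc (m + m)) → Fin (suc (m + m))} {x} →
  IsInvolutionFixingOnly α x → IsInvolutionFixingOnly β x →
  ((∀ y → y ≢ x → α y ≢ β y) × IsSingleCycle (_≢ x) (MatchingEdge α β x)) ⇔ HasCycleType1m2 (β ∘ α) m
matchingUnion⇔cycleType {m} {α} {β} {x} α-inv β-inv = mk⇔ to from
  where
    open InvolutionPair α-inv β-inv
    Matching = (∀ y → y ≢ x → α y ≢ β y) × IsSingleCycle (_≢ x) (MatchingEdge α β x)
    to : Matching → HasCycleType1m2 σ m
    to (α≢β , (k , 3≤K , f , f-injective , f-enumerates , f-edges)) =
      SingleCycle⇒CycleType.cycleType α-inv β-inv α≢β 3≤K f-injective f-enumerates f-edges
    from : HasCycleType1m2 σ m → Matching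
    from ((z , _ , z-unique) , a , b , a-cycle , b-cycle , a≁b , covered) =
        Equivalence.to σ-fixed⇒≡⇔α≢β fixed⇒x
      , CycleType⇒SingleCycle.singleCycle α-inv β-inv fixed⇒x a-cycle b-cycle a≁b covered
      where
        fixed⇒x : ∀ y → σ y ≡ y → y ≡ x
        fixed⇒x y σy≡y = trans (z-unique y σy≡y) (sym (z-unique x σ-fixes))

-- Steiner quasigroups

_∈⟨_,_,_⟩ : ∀ {n} → Fin n → Fin n → Fin n → Fin n → Set
w ∈⟨ a , b , c ⟩ = w ≡ a ⊎ w ≡ b ⊎ w ≡ c

∈triple⁻ : ∀ {n} {w a b c : Fin n} → w ∈ triple a b c → w ∈⟨ a , b , c ⟩
∈triple⁻ {a = a} {b} {c} w∈ with x∈p∪q⁻ ⁅ a ⁆ _ w∈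
... | inj₁ w∈a = inj₁ (x∈⁅y⁆⇒x≡y a w∈a)
... | inj₂ w∈bc with x∈p∪q⁻ ⁅ b ⁆ _ w∈bc
...   | inj₁ w∈b = inj₂ (inj₁ (x∈⁅y⁆⇒x≡y b w∈b))
...   | inj₂ w∈c = inj₂ (inj₂ (x∈⁅y⁆⇒x≡y c w∈c))

∈triple⁺ : ∀ {n} {w a b c : Fin n} → w ∈⟨ a , b , c ⟩ → w ∈ triple a b c
∈triple⁺ {a = a}         (inj₁ refl)        = x∈p∪q⁺ (inj₁ (x∈⁅x⁆ a))
∈triple⁺ {a = a} {b}     (inj₂ (inj₁ refl)) = x∈p∪q⁺ {p = ⁅ a ⁆} (inj₂ (x∈p∪q⁺ (inj₁ (x∈⁅x⁆ b))))
∈triple⁺ {a = a} {b} {c} (inj₂ (inj₂ refl)) = x∈p∪q⁺ {p = ⁅ a ⁆} (inj₂ (x∈p∪q⁺ {p = ⁅ b ⁆} (inj₂ (x∈⁅x⁆ c))))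

third-of : ∀ {n} {w a b c : Fin n} → w ≢ a → w ≢ b → w ∈⟨ a , b , c ⟩ → w ≡ c
third-of w≢a w≢b (inj₁ w≡a)        = ⊥-elim (w≢a w≡a)
third-of w≢a w≢b (inj₂ (inj₁ w≡b)) = ⊥-elim (w≢b w≡b)
third-of w≢a w≢b (inj₂ (inj₂ w≡c)) = w≡c

module SteinerQuasigroup {n : ℕ} {μ : Op n} (Q : IsSteinerQuasigroup μ) where
  open IsSteinerQuasigroup Q

  translation : ∀ x → IsInvolutionFixingOnly (μ x) x
  translation x = record { involutive = cancel x ; fixes = idem x ; fixed⇒≡ = fixed⇒≡ }
    where
      fixed⇒≡ : ∀ {y} → μ x y ≡ y → y ≡ x
      fixed⇒≡ {y} e = begin
        y            ≡⟨ idem y ⟨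
        μ y y        ≡⟨ cong (μ y) e ⟨
        μ y (μ x y)  ≡⟨ cong (μ y) (comm x y) ⟩
        μ y (μ y x)  ≡⟨ cancel y x ⟩
        x            ∎
        where open ≡-Reasoning

  ⊆-block : ∀ {x y u v} → u ≢ v → u ∈⟨ x , y , μ x y ⟩ → v ∈⟨ x , y , μ x y ⟩ →
            ∀ {w} → w ∈⟨ x , y , μ x y ⟩ → w ∈⟨ u , v , μ u v ⟩
  ⊆-block u≢v (inj₁ refl)        (inj₁ refl)        = ⊥-elim (u≢v refl)
  ⊆-block u≢v (inj₂ (inj₁ refl)) (inj₂ (inj₁ refl)) = ⊥-elim (u≢v refl)
  ⊆-block u≢v (inj₂ (inj₂ refl)) (inj₂ (inj₂ refl)) = ⊥-elim (u≢v refl)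
  ⊆-block _ (inj₁ refl) (inj₂ (inj₁ refl)) w∈ = w∈
  ⊆-block {x} {y} _ (inj₂ (inj₁ refl)) (inj₁ refl) = λ
    { (inj₁ e)        → inj₂ (inj₁ e)
    ; (inj₂ (inj₁ e)) → inj₁ e
    ; (inj₂ (inj₂ e)) → inj₂ (inj₂ (trans e (comm x y)))
    }
  ⊆-block {x} {y} _ (inj₁ refl) (inj₂ (inj₂ refl)) = λ
    { (inj₁ e)        → inj₁ e
    ; (inj₂ (inj₁ e)) → inj₂ (inj₂ (trans e (sym (cancel x y))))
    ; (inj₂ (inj₂ e)) → inj₂ (inj₁ e)
    }
  ⊆-block {x} {y} _ (inj₂ (inj₂ refl)) (inj₁ refl) = λ
    { (inj₁ e)        → inj₂ (inj₁ e)
    ; (inj₂ (inj₁ e)) → inj₂ (inj₂ (trans e (sym zx≡y)))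
    ; (inj₂ (inj₂ e)) → inj₁ e
    }
    where
      zx≡y : μ (μ x y) x ≡ y
      zx≡y = trans (comm (μ x y) x) (cancel x y)
  ⊆-block {x} {y} _ (inj₂ (inj₁ refl)) (inj₂ (inj₂ refl)) = λ
    { (inj₁ e)        → inj₂ (inj₂ (trans e (sym yz≡x)))
    ; (inj₂ (inj₁ e)) → inj₁ e
    ; (inj₂ (inj₂ e)) → inj₂ (inj₁ e)
    }
    where
      yz≡x : μ y (μ x y) ≡ x
      yz≡x = trans (cong (μ y) (comm x y)) (cancel y x)
  ⊆-block {x} {y} _ (inj₂ (inj₂ refl)) (inj₂ (inj₁ refl)) = λ
    { (inj₁ e)        → inj₂ (inj₂ (trans e (sym zy≡x)))
    ; (inj₂ (inj₁ e)) → inj₂ (inj₁ e)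
    ; (inj₂ (inj₂ e)) → inj₁ e
    }
    where
      zy≡x : μ (μ x y) y ≡ x
      zy≡x = trans (comm (μ x y) y) (trans (cong (μ y) (comm x y)) (cancel y x))

  InSTS-spanned : ∀ {T} → InSTS μ T → ∀ {u v w} → u ≢ v → u ∈ T → v ∈ T → w ∈ T → w ∈⟨ u , v , μ u v ⟩
  InSTS-spanned (_ , _ , _ , refl) u≢v u∈ v∈ w∈ = ⊆-block u≢v (∈triple⁻ u∈) (∈triple⁻ v∈) (∈triple⁻ w∈)

  InSTS-triple : ∀ {a b c} → InSTS μ (triple a b c) → a ≢ b → c ∈⟨ a , b , μ a b ⟩
  InSTS-triple T a≢b =
    InSTS-spanned T a≢b (∈triple⁺ (inj₁ refl)) (∈triple⁺ (inj₂ (inj₁ refl))) (∈triple⁺ (inj₂ (inj₂ refl)))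

module SteinerPair {n : ℕ} {μ⁻ μ⁺ : Op n} (Q⁻ : IsSteinerQuasigroup μ⁻) (Q⁺ : IsSteinerQuasigroup μ⁺) where
  module S⁻ = SteinerQuasigroup Q⁻
  module S⁺ = SteinerQuasigroup Q⁺
  private
    module T⁻ x = IsInvolutionFixingOnly (S⁻.translation x)
    module T⁺ x = IsInvolutionFixingOnly (S⁺.translation x)

  disjoint⇔translations-differ : (∀ T → InSTS μ⁻ T → InSTS μ⁺ T → ⊥) ⇔ (∀ x y → y ≢ x → μ⁺ x y ≢ μ⁻ x y)
  disjoint⇔translations-differ = mk⇔ to from
    where
      to : (∀ T → InSTS μ⁻ T → InSTS μ⁺ T → ⊥) → ∀ x y → y ≢ x → μ⁺ x y ≢ μ⁻ x y
      to disjoint x y y≢x e =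
        disjoint (triple x y (μ⁻ x y)) (x , y , y≢x ∘ sym , refl) (x , y , y≢x ∘ sym , cong (triple x y) (sym e))
      from : (∀ x y → y ≢ x → μ⁺ x y ≢ μ⁻ x y) → ∀ T → InSTS μ⁻ T → InSTS μ⁺ T → ⊥
      from differ T (x , y , x≢y , refl) T⁺ = differ x y (x≢y ∘ sym)
        (sym (third-of (x≢y ∘ sym ∘ T⁻.preimage-fixed x) (x≢y ∘ sym ∘ T⁻.fixed⇒≡ x) (S⁺.InSTS-triple T⁺ x≢y)))

  linkEdge⇔ : ∀ x a b → LinkEdge μ⁻ μ⁺ x a b ⇔ MatchingEdge (μ⁺ x) (μ⁻ x) x a b
  linkEdge⇔ x a b = mk⇔ to from
    where
      to : LinkEdge μ⁻ μ⁺ x a b → MatchingEdge (μ⁺ x) (μ⁻ x) x a b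
      to (a≢x , b≢x , a≢b , inj₁ T) = a≢x , inj₁ (third-of b≢x (a≢b ∘ sym) (S⁻.InSTS-triple T (a≢x ∘ sym)))
      to (a≢x , b≢x , a≢b , inj₂ T) = a≢x , inj₂ (third-of b≢x (a≢b ∘ sym) (S⁺.InSTS-triple T (a≢x ∘ sym)))
      from : MatchingEdge (μ⁺ x) (μ⁻ x) x a b → LinkEdge μ⁻ μ⁺ x a b
      from (a≢x , inj₁ refl) =
        a≢x , a≢x ∘ T⁻.preimage-fixed x , a≢x ∘ T⁻.fixed⇒≡ x ∘ sym , inj₁ (x , a , a≢x ∘ sym , refl)
      from (a≢x , inj₂ refl) =
        a≢x , a≢x ∘ T⁺.preimage-fixed x , a≢x ∘ T⁺.fixed⇒≡ x ∘ sym , inj₂ (x , a , a≢x ∘ sym , refl)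

  linkVertex⇔ : ∀ x u → LinkVertex μ⁻ μ⁺ x u ⇔ u ≢ x
  linkVertex⇔ x u = mk⇔ (λ (_ , u≢x , _) → u≢x)
                        (λ u≢x → μ⁻ x u , Equivalence.from (linkEdge⇔ x u _) (u≢x , inj₁ refl))

mainTheorem12 : (m : ℕ) (μ⁻ μ⁺ : Op (suc (m + m)))
    → IsSteinerQuasigroup μ⁻ → IsSteinerQuasigroup μ⁺
    → IsSteinerSurface μ⁻ μ⁺ ⇔ (∀ x → HasCycleType1m2 (transition μ⁻ x μ⁺) m)
mainTheorem12 m μ⁻ μ⁺ Q⁻ Q⁺ = mk⇔ to from
  where
    open SteinerPair Q⁻ Q⁺
    local⇔ : ∀ x → _ ⇔ HasCycleType1m2 (transition μ⁻ x μ⁺) m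
    local⇔ x = matchingUnion⇔cycleType (S⁺.translation x) (S⁻.translation x)
    to : IsSteinerSurface μ⁻ μ⁺ → ∀ x → HasCycleType1m2 (transition μ⁻ x μ⁺) m
    to (disjoint , links) x = Equivalence.to (local⇔ x)
      ( Equivalence.to disjoint⇔translations-differ disjoint x
      , IsSingleCycle-resp (linkVertex⇔ x) (linkEdge⇔ x) (links x))
    from : (∀ x → HasCycleType1m2 (transition μ⁻ x μ⁺) m) → IsSteinerSurface μ⁻ μ⁺
    from types = Equivalence.from disjoint⇔translations-differ (proj₁ ∘ local)
               , λ x → IsSingleCycle-resp (⇔-sym ∘ linkVertex⇔ x) (λ a b → ⇔-sym (linkEdge⇔ x a b)) (proj₂ (local x))
      where local = λ x → Equivalence.from (local⇔ x) (types x)
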